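{- Let $m\ge1$ and let $t_1, \ldots, t_m$ and $r_1, \ldots, r_m$ be integers satisfying $t_i > r_i \geq 0$ for each $i \in [m]$. Let $M$ be a block matrix with $m$ square diagonal blocks, such that for each $i \in [m]$ the $i$th diagonal block of $M$ belongs to $\mathcal{M}_{t_i,r_i}$, and all of whose other entries (outside the diagonal blocks) are ones. Then \[\mathrm{rank}_{\mathrm{bin}}(M) \leq \sum_{i =1}^{m}{(t_i-r_i)} + \max_{i \in [m]}{r_i}.\]
   Context: For integers $t > r \geq 0$, $\mathcal{M}_{t,r}$ is the collection of all $0,1$ matrices $A$ of dimensions $n \times n$ (for some $n \geq 1$) for which there exist sets $A_1, \ldots, A_t \subseteq [n]$ (of rows) and $B_1, \ldots, B_t \subseteq [n]$ (of columns) such that: (1) the combinatorial rectangles $A_1 \times B_1, \ldots, A_t \times B_t$ form a partition of the ones in $A$; (2) the sets $A_1, \ldots, A_r$ are pairwise disjoint; (3) there exists a set $L \subseteq [t] \setminus [r]$ for which the sets $B_l$ with $l \in L$ form a partition of $[n]$; (4) for every $s \in [r]$, there exists a set $L_s \subseteq [t] \setminus [r]$ for which the sets $B_l$ with $l \in L_s$ form a partition of $[n] \setminus B_s$. The binary rank $\mathrm{rank}_{\mathrm{bin}}(A)$ of a $0,1$ matrix $A$ is the smallest number of combinatorial rectangles (all-one submatrices indexed by a set of rows times a set of columns) that partition the ones of $A$. -}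

module Defs where

open import Data.Nat using (ℕ; zero; suc; _+_; _∸_; _⊔_; _≤_; _<_)
open import Data.Bool using (Bool; true; false; if_then_else_; _∧_)
open import Data.Fin using (Fin; zero; suc; toℕ; splitAt; _≟_)
open import Data.Sum using (inj₁; inj₂)
open import Data.Product using (Σ; Σ-syntax; ∃; ∃-syntax; _×_; _,_)
open import Relation.Binary.PropositionalEquality using (_≡_; refl)
open import Relation.Nullary using (yes; no)

Matrix : ℕ → Set
Matrix n = Fin n → Fin n → Bool

Subset : ℕ → Set
Subset n = Fin n → Bool

count : ∀ {t} → (Fin t → Bool) → ℕ
count {zero}  p = 0
count {suc t} p = (if p zero then 1 else 0) + count (λ k → p (suc k))

ind : Bool → ℕ
ind b = if b then 1 else 0

PartitionsOnes : ∀ {n t} → Matrix n → (Fin t → Subset n) → (Fin t → Subset n) → Set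
PartitionsOnes {n} {t} M A B = ∀ (i j : Fin n) → count (λ k → A k i ∧ B k j) ≡ ind (M i j)

-- rank_bin(M) ≤ K : the ones of M can be partitioned into at most K combinatorial rectangles
-- (the binary rank is the least such number, so this is exactly "rank_bin(M) ≤ K").
BinRankAtMost : ∀ {n} → Matrix n → ℕ → Set
BinRankAtMost {n} M K =
  Σ[ k ∈ ℕ ] (k ≤ K × Σ[ A ∈ (Fin k → Subset n) ] Σ[ B ∈ (Fin k → Subset n) ] PartitionsOnes M A B)

FamilyPartitions : ∀ {n t} → (Fin t → Subset n) → Subset (t) → Subset n → Set
FamilyPartitions {n} B L S = ∀ (j : Fin n) → count (λ l → L l ∧ B l j) ≡ ind (S j)

not : Bool → Bool
not true = false
not false = true

-- L ⊆ [t] \ [r]  (with 0-based indices: every l ∈ L has toℕ l ≥ r)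
AvoidsFirst : ∀ {t} → ℕ → Subset t → Set
AvoidsFirst {t} r L = ∀ (l : Fin t) → L l ≡ true → r ≤ toℕ l

InM : (t r : ℕ) → ∀ {n} → Matrix n → Set
InM t r {n} M =
  Σ[ A ∈ (Fin t → Subset n) ] Σ[ B ∈ (Fin t → Subset n) ]
    ( PartitionsOnes M A B
    -- (2) A_1,…,A_r pairwise disjoint (indices 0..r-1 here)
    × (∀ (i : Fin n) → count (λ k → (if (toℕ k Data.Nat.<ᵇ r) then A k i else false)) ≤ 1)
    × (Σ[ L ∈ Subset t ] (AvoidsFirst r L × FamilyPartitions B L (λ _ → true)))
    × (∀ (s : Fin t) → toℕ s < r →
         Σ[ L ∈ Subset t ] (AvoidsFirst r L × FamilyPartitions B L (λ j → not (B s j)))))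

sumF : ∀ {m} → (Fin m → ℕ) → ℕ
sumF {zero}  f = 0
sumF {suc m} f = f zero + sumF (λ i → f (suc i))

maxF : ∀ {m} → (Fin m → ℕ) → ℕ
maxF {zero}  f = 0
maxF {suc m} f = f zero ⊔ maxF (λ i → f (suc i))

locate : ∀ {m} (n : Fin m → ℕ) → Fin (sumF n) → Σ (Fin m) (λ i → Fin (n i))
locate {zero}  n ()
locate {suc m} n x with splitAt (n zero) x
... | inj₁ y = zero , y
... | inj₂ y with locate (λ i → n (suc i)) y
...   | (i , z) = suc i , z

blockEntry : ∀ {m} (n : Fin m → ℕ) (D : (i : Fin m) → Matrix (n i)) →
             Σ (Fin m) (λ i → Fin (n i)) → Σ (Fin m) (λ i → Fin (n i)) → Bool
blockEntry n D (a , x) (b , y) with a ≟ b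
... | yes refl = D a x y
... | no _     = true

BlockMatrix : ∀ {m} (n : Fin m → ℕ) (D : (i : Fin m) → Matrix (n i)) → Matrix (sumF n)
BlockMatrix n D x y = blockEntry n D (locate n x) (locate n y)

{-# OPTIONS --safe #-}
-- Write the i-th diagonal block as a disjoint union of rectangles A^i_k × B^i_k, the first r_i
-- of them ("special") having pairwise disjoint row sets. The new partition consists of
--  * for each special index z < max r_i, the rectangle whose rows are A^i_z in every block i with
--    z < r_i and whose columns are B^j_z in every block j with z < r_j and all of block j otherwise;
--  * for each non-special (j , k), the rectangle A^j_k × B^j_k enlarged by those rows x of other
--    blocks i for which k ∈ L^j_z when x lies in the special rectangle z of block i (with L^j_z the
--    family partitioning the complement of B^j_z, or empty if z ≥ r_j), and k ∈ L^j when x lies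
--    in no special rectangle.
-- Inside block i these rectangles restrict to the given partition, the special ones by disjointness
-- of the special rows. For an entry (x , y) outside the diagonal blocks, with y in block j, either
-- the special rectangle z of x covers y, or y lies in the complement of B^j_z, which the L^j_z part
-- covers exactly once; if x is in no special rectangle, the partition L^j of all columns does.
module Submission where

open import Defs
open import Data.Nat using (ℕ; zero; suc; _+_; _∸_; _≤_; _<_; _<ᵇ_; _≡ᵇ_; s≤s; s≤s⁻¹)
open import Data.Nat.Properties
  using (+-identityʳ; +-assoc; n≤0⇒n≡0; ≤-refl; +-suc; <-trans; <-≤-trans; <⇒≤; <⇒≱; m+[n∸m]≡n; m≤m⊔n; m≤n⇒m≤o⊔n; <ᵇ⇒<; _<?_)
open import Data.Fin using (Fin; zero; suc; toℕ; splitAt; _↑ʳ_; cast; fromℕ<; _≟_)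
open import Data.Fin.Properties using (cast-is-id; fromℕ<-toℕ; toℕ-fromℕ<; suc-injective)
open import Data.Bool using (Bool; true; false; if_then_else_; _∧_)
open import Data.Bool.Properties using (∧-assoc; ∧-zeroʳ; T-≡)
open import Data.Sum using (_⊎_; inj₁; inj₂; [_,_]′; map₁)
open import Data.Product using (Σ; _,_; proj₁; proj₂)
open import Data.Maybe using (Maybe; just; nothing; maybe′)
import Data.Maybe as Maybe
open import Function using (_∘_)
open import Function.Bundles using (Equivalence)
open import Relation.Binary.PropositionalEquality using (_≡_; _≢_; refl; sym; trans; cong; cong₂; cong-app; subst; module ≡-Reasoning)
open import Relation.Nullary using (yes; no; contradiction)

<ᵇ-true⇒< : ∀ {a b} → (a <ᵇ b) ≡ true → a < b
<ᵇ-true⇒< {a} {b} e = <ᵇ⇒< a b (Equivalence.from T-≡ e)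

count-cong : ∀ {t} {p q : Fin t → Bool} → (∀ k → p k ≡ q k) → count p ≡ count q
count-cong {zero}  e = refl
count-cong {suc t} e = cong₂ _+_ (cong ind (e zero)) (count-cong (e ∘ suc))

count-false : ∀ {t} {p : Fin t → Bool} → (∀ k → p k ≡ false) → count p ≡ 0
count-false {zero}  e = refl
count-false {suc t} e rewrite e zero = count-false (e ∘ suc)

count≡0⇒false : ∀ {t} (p : Fin t → Bool) → count p ≡ 0 → ∀ k → p k ≡ false
count≡0⇒false {suc t} p e k with p zero in pz
count≡0⇒false {suc t} p () k      | true
count≡0⇒false {suc t} p e zero    | false = pz
count≡0⇒false {suc t} p e (suc k) | false = count≡0⇒false (p ∘ suc) e k

count-splitAt : ∀ a {b} (h : Fin a ⊎ Fin b → Bool) →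
  count (h ∘ splitAt a) ≡ count (h ∘ inj₁) + count (h ∘ inj₂)
count-splitAt zero    h = refl
count-splitAt (suc a) h =
  trans (cong (ind (h (inj₁ zero)) +_) (count-splitAt a (h ∘ map₁ suc)))
        (sym (+-assoc (ind (h (inj₁ zero))) _ _))

-- Rectangle k is the paper's rectangle k + 1, so the special ones A_1 … A_r are those with k < r.
isSpecial : ∀ {t} → ℕ → Fin t → Bool
isSpecial r k = toℕ k <ᵇ r

count-↑ʳ : ∀ r {u} (F : Fin (r + u) → Bool) →
  count (λ l → F (r ↑ʳ l)) ≡ count (λ k → not (isSpecial r k) ∧ F k)
count-↑ʳ zero    F = refl
count-↑ʳ (suc r) F = count-↑ʳ r (F ∘ suc)

count-cast-↑ʳ : ∀ {r u t} (eq : r + u ≡ t) (F : Fin t → Bool) →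
  count (λ l → F (cast eq (r ↑ʳ l))) ≡ count (λ k → not (isSpecial r k) ∧ F k)
count-cast-↑ʳ {r} refl F = trans (count-cong (λ l → cong F (cast-is-id refl (r ↑ʳ l)))) (count-↑ʳ r F)

count-not∧+count-∧ : ∀ {t} (c p : Fin t → Bool) →
  count (λ k → not (c k) ∧ p k) + count (λ k → c k ∧ p k) ≡ count p
count-not∧+count-∧ {zero}  c p = refl
count-not∧+count-∧ {suc t} c p with c zero | p zero | count-not∧+count-∧ (c ∘ suc) (p ∘ suc)
... | true  | true  | ih = trans (+-suc _ _) (cong suc ih)
... | true  | false | ih = ih
... | false | true  | ih = cong suc ih
... | false | false | ih = ih

first : ∀ {t} → (Fin t → Bool) → Maybe (Fin t)
first {zero}  p = nothing
first {suc t} p with p zero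
... | true  = just zero
... | false = Maybe.map suc (first (p ∘ suc))

first-true : ∀ {t} (p : Fin t → Bool) {k} → first p ≡ just k → p k ≡ true
first-true {suc t} p e with p zero in pz
first-true {suc t} p refl | true = pz
first-true {suc t} p e    | false with first (p ∘ suc) in fe
first-true {suc t} p refl | false | just k = first-true (p ∘ suc) fe

count-∧-first : ∀ {t} (p q : Fin t → Bool) → count p ≤ 1 →
  count (λ k → p k ∧ q k) ≡ maybe′ (ind ∘ q) 0 (first p)
count-∧-first {zero}  p q _ = refl
count-∧-first {suc t} p q p≤1 with p zero
... | true = trans (cong (ind (q zero) +_) (count-false rest-false)) (+-identityʳ _)
  where
  rest-false : ∀ k → p (suc k) ∧ q (suc k) ≡ false
  rest-false k = cong (_∧ q (suc k)) (count≡0⇒false (p ∘ suc) (n≤0⇒n≡0 (s≤s⁻¹ p≤1)) k)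
count-∧-first {suc t} p q p≤1 | false =
  trans (count-∧-first (p ∘ suc) (q ∘ suc) p≤1) (maybe-suc (first (p ∘ suc)))
  where
  maybe-suc : (mk : Maybe (Fin t)) → maybe′ (ind ∘ q ∘ suc) 0 mk ≡ maybe′ (ind ∘ q) 0 (Maybe.map suc mk)
  maybe-suc (just k) = refl
  maybe-suc nothing  = refl

maybe′-cong : ∀ {A : Set} {f g : A → ℕ} {b} (mk : Maybe A) → (∀ {a} → mk ≡ just a → f a ≡ g a) →
  maybe′ f b mk ≡ maybe′ g b mk
maybe′-cong (just a) e = e refl
maybe′-cong nothing  e = refl

count-≡ᵇ : ∀ {R} x (g : ℕ → Bool) → x < R → count {R} (λ s → (x ≡ᵇ toℕ s) ∧ g (toℕ s)) ≡ ind (g x)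
count-≡ᵇ {suc R} zero    g _         = trans (cong (ind (g 0) +_) (count-false {R} (λ _ → refl))) (+-identityʳ _)
count-≡ᵇ {suc R} (suc x) g (s≤s x<R) = count-≡ᵇ x (g ∘ suc) x<R

sumF-false : ∀ {m} (f : Fin m → ℕ) → (∀ j → f j ≡ 0) → sumF f ≡ 0
sumF-false {zero}  f e = refl
sumF-false {suc m} f e = cong₂ _+_ (e zero) (sumF-false (f ∘ suc) (e ∘ suc))

sumF-single : ∀ {m} (f : Fin m → ℕ) (j : Fin m) → (∀ i → i ≢ j → f i ≡ 0) → sumF f ≡ f j
sumF-single {suc m} f zero    e =
  trans (cong (f zero +_) (sumF-false (f ∘ suc) (λ i → e (suc i) λ ()))) (+-identityʳ _)
sumF-single {suc m} f (suc j) e =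
  trans (cong (_+ sumF (f ∘ suc)) (e zero λ ()))
        (sumF-single (f ∘ suc) j (λ i i≢j → e (suc i) (i≢j ∘ suc-injective)))

≤-maxF : ∀ {m} (f : Fin m → ℕ) i → f i ≤ maxF f
≤-maxF f zero    = m≤m⊔n (f zero) _
≤-maxF f (suc i) = m≤n⇒m≤o⊔n (f zero) (≤-maxF (f ∘ suc) i)

count-locate : ∀ {m} (u : Fin m → ℕ) (h : Σ (Fin m) (Fin ∘ u) → Bool) →
  count (h ∘ locate u) ≡ sumF (λ j → count (λ l → h (j , l)))
count-locate {zero}  u h = refl
count-locate {suc m} u h =
  trans (count-cong split)
  (trans (count-splitAt (u zero) h′)
         (cong (count (λ l → h (zero , l)) +_) (count-locate (u ∘ suc) (λ (j , l) → h (suc j , l)))))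
  where
  h′ : Fin (u zero) ⊎ Fin (sumF (u ∘ suc)) → Bool
  h′ (inj₁ l) = h (zero , l)
  h′ (inj₂ a) with locate (u ∘ suc) a
  ... | j , l = h (suc j , l)
  split : ∀ a → h (locate u a) ≡ h′ (splitAt (u zero) a)
  split a with splitAt (u zero) a
  ... | inj₁ l = refl
  ... | inj₂ a′ with locate (u ∘ suc) a′
  ...   | j , l = refl

count-avoiding : ∀ {t} r (L G : Fin t → Bool) → AvoidsFirst r L →
  count (λ k → not (isSpecial r k) ∧ (L k ∧ G k)) ≡ count (λ k → L k ∧ G k)
count-avoiding r L G avoids = count-cong drop-special
  where
  drop-special : ∀ k → not (isSpecial r k) ∧ (L k ∧ G k) ≡ L k ∧ G k
  drop-special k with isSpecial r k in special | L k in inL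
  ... | false | _     = refl
  ... | true  | false = refl
  ... | true  | true  = contradiction (avoids k inL) (<⇒≱ (<ᵇ-true⇒< special))

record Decomposition (t r : ℕ) {n : ℕ} (M : Matrix n) : Set where
  field
    rows cols              : Fin t → Subset n
    partitions             : PartitionsOnes M rows cols
    special-disjoint       : ∀ x → count (λ k → isSpecial r k ∧ rows k x) ≤ 1
    cover                  : Subset t
    cover-avoids           : AvoidsFirst r cover
    cover-partitions       : FamilyPartitions cols cover (λ _ → true)
    complement             : ∀ s → toℕ s < r → Subset t
    complement-avoids      : ∀ s s<r → AvoidsFirst r (complement s s<r)
    complement-partitions  : ∀ s s<r → FamilyPartitions cols (complement s s<r) (λ y → not (cols s y))

ind-not+ind : ∀ b → ind (not b) + ind b ≡ 1
ind-not+ind true  = refl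
ind-not+ind false = refl

if-then-false : ∀ b c → (if b then c else false) ≡ b ∧ c
if-then-false true  c = refl
if-then-false false c = refl

fromInM : ∀ {t r n} {M : Matrix n} → InM t r M → Decomposition t r M
fromInM {r = r} (A , B , part , disjoint , (L , L-avoids , L-part) , complement) = record
  { rows                  = A
  ; cols                  = B
  ; partitions            = part
  ; special-disjoint      = λ x → subst (_≤ 1) (count-cong (λ k → if-then-false (isSpecial r k) (A k x))) (disjoint x)
  ; cover                 = L
  ; cover-avoids          = L-avoids
  ; cover-partitions      = L-part
  ; complement            = λ s s<r → proj₁ (complement s s<r)
  ; complement-avoids     = λ s s<r → proj₁ (proj₂ (complement s s<r))
  ; complement-partitions = λ s s<r → proj₂ (proj₂ (complement s s<r))
  }

module Construction {m : ℕ} {t r n : Fin m → ℕ} (r<t : ∀ i → r i < t i)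
                    (D : (i : Fin m) → Matrix (n i))
                    (dec : ∀ i → Decomposition (t i) (r i) (D i)) where

  open Decomposition

  Entry : Set
  Entry = Σ (Fin m) (Fin ∘ n)

  u : Fin m → ℕ
  u i = t i ∸ r i

  r+u≡t : ∀ i → r i + u i ≡ t i
  r+u≡t i = m+[n∸m]≡n (<⇒≤ (r<t i))

  nonSpecial : ∀ i → Fin (u i) → Fin (t i)
  nonSpecial i l = cast (r+u≡t i) (r i ↑ʳ l)

  special : ∀ j {z} → z < r j → Fin (t j)
  special j z<r = fromℕ< (<-trans z<r (r<t j))

  special-< : ∀ j {z} (z<r : z < r j) → toℕ (special j z<r) < r j
  special-< j z<r = subst (_< r j) (sym (toℕ-fromℕ< _)) z<r

  nonSpecial-partitions : ∀ j (L : Subset (t j)) {S : Subset (n j)} → AvoidsFirst (r j) L →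
    FamilyPartitions (cols (dec j)) L S →
    ∀ y → count (λ l → L (nonSpecial j l) ∧ cols (dec j) (nonSpecial j l) y) ≡ ind (S y)
  nonSpecial-partitions j L avoids part y =
    trans (count-cast-↑ʳ {r j} (r+u≡t j) (λ k → L k ∧ cols (dec j) k y))
          (trans (count-avoiding (r j) L (λ k → cols (dec j) k y) avoids) (part y))

  specialRowOf : ∀ i → Fin (n i) → Maybe (Fin (t i))
  specialRowOf i x = first (λ k → isSpecial (r i) k ∧ rows (dec i) k x)

  specialRowOf-< : ∀ i x {k} → specialRowOf i x ≡ just k → toℕ k < r i
  specialRowOf-< i x {k} e with isSpecial (r i) k in special | first-true _ e
  ... | true  | _  = <ᵇ-true⇒< special
  ... | false | ()

  colsAt : ∀ j → ℕ → Subset (n j)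
  colsAt j z with z <? r j
  ... | yes z<r = cols (dec j) (special j z<r)
  ... | no _    = λ _ → true

  colsAt-special : ∀ j k → toℕ k < r j → colsAt j (toℕ k) ≡ cols (dec j) k
  colsAt-special j k k<r with toℕ k <? r j
  ... | yes _   = cong (cols (dec j)) (fromℕ<-toℕ k _)
  ... | no k≮r  = contradiction k<r k≮r

  complementAt : ∀ j → ℕ → Subset (t j)
  complementAt j z with z <? r j
  ... | yes z<r = complement (dec j) (special j z<r) (special-< j z<r)
  ... | no _    = λ _ → false

  coverFor : ∀ j {t′} → Maybe (Fin t′) → Subset (t j)
  coverFor j nothing  = cover (dec j)
  coverFor j (just k) = complementAt j (toℕ k)

  coverFor-complete : ∀ j y {t′} (mk : Maybe (Fin t′)) →
    count (λ l → coverFor j mk (nonSpecial j l) ∧ cols (dec j) (nonSpecial j l) y)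
      + maybe′ (λ k → ind (colsAt j (toℕ k) y)) 0 mk ≡ 1
  coverFor-complete j y nothing =
    trans (+-identityʳ _) (nonSpecial-partitions j _ (cover-avoids (dec j)) (cover-partitions (dec j)) y)
  coverFor-complete j y (just k) with toℕ k <? r j
  ... | yes z<r = trans (cong (_+ ind (cols (dec j) s y)) complement-count) (ind-not+ind (cols (dec j) s y))
    where
    s : Fin (t j)
    s = special j z<r
    complement-count : count (λ l → complement (dec j) s (special-< j z<r) (nonSpecial j l)
                                      ∧ cols (dec j) (nonSpecial j l) y)
                         ≡ ind (not (cols (dec j) s y))
    complement-count = nonSpecial-partitions j _ (complement-avoids (dec j) s (special-< j z<r))
                                                 (complement-partitions (dec j) s (special-< j z<r)) y
  ... | no _    = cong (_+ 1) (count-false {u j} (λ _ → refl))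

  R : ℕ
  R = maxF r

  nonSpecialRows : Σ (Fin m) (Fin ∘ u) → Entry → Bool
  nonSpecialRows (j , l) (i , x) with j ≟ i
  ... | yes refl = rows (dec j) (nonSpecial j l) x
  ... | no _     = coverFor j (specialRowOf i x) (nonSpecial j l)

  nonSpecialCols : Σ (Fin m) (Fin ∘ u) → Entry → Bool
  nonSpecialCols (j , l) (i , y) with j ≟ i
  ... | yes refl = cols (dec j) (nonSpecial j l) y
  ... | no _     = false

  specialRows : ℕ → Entry → Bool
  specialRows z (i , x) = maybe′ (λ k → toℕ k ≡ᵇ z) false (specialRowOf i x)

  specialCols : ℕ → Entry → Bool
  specialCols z (j , y) = colsAt j z y

  rowSets colSets : Fin (sumF u + R) → Entry → Bool
  rowSets c = [ nonSpecialRows ∘ locate u , specialRows ∘ toℕ ]′ (splitAt (sumF u) c)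
  colSets c = [ nonSpecialCols ∘ locate u , specialCols ∘ toℕ ]′ (splitAt (sumF u) c)

  nonSpecialRows-same : ∀ j l x → nonSpecialRows (j , l) (j , x) ≡ rows (dec j) (nonSpecial j l) x
  nonSpecialRows-same j l x with j ≟ j
  ... | yes refl = refl
  ... | no j≢j   = contradiction refl j≢j

  nonSpecialRows-other : ∀ i j → i ≢ j → ∀ l x →
    nonSpecialRows (j , l) (i , x) ≡ coverFor j (specialRowOf i x) (nonSpecial j l)
  nonSpecialRows-other i j i≢j l x with j ≟ i
  ... | yes refl = contradiction refl i≢j
  ... | no _     = refl

  nonSpecialCols-same : ∀ j l y → nonSpecialCols (j , l) (j , y) ≡ cols (dec j) (nonSpecial j l) y
  nonSpecialCols-same j l y with j ≟ j
  ... | yes refl = refl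
  ... | no j≢j   = contradiction refl j≢j

  nonSpecialCols-other : ∀ i j → i ≢ j → ∀ l y → nonSpecialCols (i , l) (j , y) ≡ false
  nonSpecialCols-other i j i≢j l y with i ≟ j
  ... | yes refl = contradiction refl i≢j
  ... | no _     = refl

  count-nonSpecial : ∀ p j y →
    count (λ a → nonSpecialRows (locate u a) p ∧ nonSpecialCols (locate u a) (j , y))
      ≡ count (λ l → nonSpecialRows (j , l) p ∧ cols (dec j) (nonSpecial j l) y)
  count-nonSpecial p j y =
    trans (count-locate u (λ w → nonSpecialRows w p ∧ nonSpecialCols w (j , y)))
    (trans (sumF-single _ j (λ i i≢j → count-false (λ l →
              trans (cong (nonSpecialRows (i , l) p ∧_) (nonSpecialCols-other i j i≢j l y)) (∧-zeroʳ _))))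
           (count-cong (λ l → cong (nonSpecialRows (j , l) p ∧_) (nonSpecialCols-same j l y))))

  count-special : ∀ i x q →
    count {R} (λ s → specialRows (toℕ s) (i , x) ∧ specialCols (toℕ s) q)
      ≡ maybe′ (λ k → ind (specialCols (toℕ k) q)) 0 (specialRowOf i x)
  count-special i x q with specialRowOf i x in found
  ... | nothing = count-false {R} (λ _ → refl)
  ... | just k  = count-≡ᵇ (toℕ k) (λ z → specialCols z q) (<-≤-trans (specialRowOf-< i x found) (≤-maxF r i))

  count-rectangles : ∀ i x j y →
    count (λ c → rowSets c (i , x) ∧ colSets c (j , y))
      ≡ count (λ l → nonSpecialRows (j , l) (i , x) ∧ cols (dec j) (nonSpecial j l) y)
        + maybe′ (λ k → ind (colsAt j (toℕ k) y)) 0 (specialRowOf i x)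
  count-rectangles i x j y =
    trans (count-cong byPart)
    (trans (count-splitAt (sumF u) h)
           (cong₂ _+_ (count-nonSpecial (i , x) j y) (count-special i x (j , y))))
    where
    h : Fin (sumF u) ⊎ Fin R → Bool
    h = [ (λ a → nonSpecialRows (locate u a) (i , x) ∧ nonSpecialCols (locate u a) (j , y))
        , (λ s → specialRows (toℕ s) (i , x) ∧ specialCols (toℕ s) (j , y)) ]′
    byPart : ∀ c → rowSets c (i , x) ∧ colSets c (j , y) ≡ h (splitAt (sumF u) c)
    byPart c with splitAt (sumF u) c
    ... | inj₁ _ = refl
    ... | inj₂ _ = refl

  diagonal : ∀ i x y → count (λ c → rowSets c (i , x) ∧ colSets c (i , y)) ≡ ind (D i x y)
  diagonal i x y = begin
    count (λ c → rowSets c (i , x) ∧ colSets c (i , y))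
      ≡⟨ count-rectangles i x i y ⟩
    count (λ l → nonSpecialRows (i , l) (i , x) ∧ B (nonSpecial i l) y)
      + maybe′ (λ k → ind (colsAt i (toℕ k) y)) 0 (specialRowOf i x)
      ≡⟨ cong₂ _+_ nonSpecial-part special-part ⟩
    count (λ k → not (isSpecial (r i) k) ∧ entryIn k) + count (λ k → isSpecial (r i) k ∧ entryIn k)
      ≡⟨ count-not∧+count-∧ (isSpecial (r i)) entryIn ⟩
    count entryIn
      ≡⟨ partitions (dec i) x y ⟩
    ind (D i x y) ∎
    where
    open ≡-Reasoning
    A B : Fin (t i) → Subset (n i)
    A = rows (dec i)
    B = cols (dec i)
    entryIn : Fin (t i) → Bool
    entryIn k = A k x ∧ B k y
    nonSpecial-part : count (λ l → nonSpecialRows (i , l) (i , x) ∧ B (nonSpecial i l) y)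
                        ≡ count (λ k → not (isSpecial (r i) k) ∧ entryIn k)
    nonSpecial-part = trans (count-cong (λ l → cong (_∧ B (nonSpecial i l) y) (nonSpecialRows-same i l x)))
                            (count-cast-↑ʳ {r i} (r+u≡t i) entryIn)
    special-part : maybe′ (λ k → ind (colsAt i (toℕ k) y)) 0 (specialRowOf i x)
                     ≡ count (λ k → isSpecial (r i) k ∧ entryIn k)
    special-part = begin
      maybe′ (λ k → ind (colsAt i (toℕ k) y)) 0 (specialRowOf i x)
        ≡⟨ maybe′-cong (specialRowOf i x)
             (λ found → cong ind (cong-app (colsAt-special i _ (specialRowOf-< i x found)) y)) ⟩
      maybe′ (λ k → ind (B k y)) 0 (specialRowOf i x)
        ≡⟨ count-∧-first (λ k → isSpecial (r i) k ∧ A k x) (λ k → B k y) (special-disjoint (dec i) x) ⟨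
      count (λ k → (isSpecial (r i) k ∧ A k x) ∧ B k y)
        ≡⟨ count-cong (λ k → ∧-assoc (isSpecial (r i) k) (A k x) (B k y)) ⟩
      count (λ k → isSpecial (r i) k ∧ entryIn k) ∎

  offDiagonal : ∀ i x j y → i ≢ j → count (λ c → rowSets c (i , x) ∧ colSets c (j , y)) ≡ 1
  offDiagonal i x j y i≢j =
    trans (count-rectangles i x j y)
    (trans (cong (_+ maybe′ (λ k → ind (colsAt j (toℕ k) y)) 0 (specialRowOf i x))
                 (count-cong (λ l → cong (_∧ cols (dec j) (nonSpecial j l) y) (nonSpecialRows-other i j i≢j l x))))
           (coverFor-complete j y (specialRowOf i x)))

  rectangles-partition : ∀ p q → count (λ c → rowSets c p ∧ colSets c q) ≡ ind (blockEntry n D p q)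
  rectangles-partition (i , x) (j , y) with i ≟ j
  ... | yes refl = diagonal i x y
  ... | no i≢j   = offDiagonal i x j y i≢j

theorem3p2 : (m : ℕ) → 1 ≤ m →
    (t r : Fin m → ℕ) → (∀ i → r i < t i) →
    (n : Fin m → ℕ) → (∀ i → 1 ≤ n i) →
    (D : (i : Fin m) → Matrix (n i)) → (∀ i → InM (t i) (r i) (D i)) →
    BinRankAtMost (BlockMatrix n D) (sumF (λ i → t i ∸ r i) + maxF r)
theorem3p2 m _ t r r<t n _ D inM =
  sumF u + R , ≤-refl ,
  (λ c x → rowSets c (locate n x)) , (λ c y → colSets c (locate n y)) ,
  (λ x y → rectangles-partition (locate n x) (locate n y))
  where open Construction r<t D (λ i → fromInM (inM i))
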